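{- Let $f_i\colon M_i\to M_{i+1}$ ($i\geqslant0$) be a sequence of posets and monotone maps, and define $M^{(k)}_n$, $f^{(k)}_n$ and $\iota^{(k)}_n$ as in the context. Then for all $k,n\geqslant 0$ the square with $K=M^{(k)}_n$, $M=M^{(k)}_{n+1}$, $N=M^{(k+1)}_n$, $L=M^{(k+1)}_{n+1}$, $f=f^{(k)}_n\colon K\to M$, $g=\iota^{(k)}_n\colon K\to N$, $f'=f^{(k+1)}_n\colon N\to L$, $g'=\iota^{(k)}_{n+1}\colon M\to L$ is a lax pushout.
   Context: Stacking: for a sequence of posets $P_0,P_1,\dots$ with monotone maps $h_j\colon P_j\to P_{j+1}$, $\Sigma_nP_n$ is the poset of pairs $(x,j)$, $0\leqslant j\leqslant n$, $x\in P_j$, with $(x,j)\leqslant(y,k)$ iff $j\leqslant k$ and $(h_{k-1}\circ\dots\circ h_j)(x)\leqslant y$ (identity composite when $j=k$). Define recursively $M^{(0)}_n=M_n$, $f^{(0)}_n=f_n$; $M^{(k+1)}_n=\Sigma_nM^{(k)}_n$ (stacking of the sequence $(M^{(k)}_n,f^{(k)}_n)$), $f^{(k+1)}_n\colon M^{(k+1)}_n\to M^{(k+1)}_{n+1}$, $(x,j)\mapsto(x,j)$; and $\iota^{(k)}_n\colon M^{(k)}_n\to M^{(k+1)}_n$, $x\mapsto(x,n)$. A square of posets and monotone maps $f\colon K\to M$, $g\colon K\to N$, $f'\colon N\to L$, $g'\colon M\to L$ is a lax pushout if: $f'$ and $g'$ are order-reflecting (hence injective) with disjoint images whose union is $L$;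 the image of $f'$ is down-closed; and for all $a\in N$, $b\in M$, $f'(a)\leqslant g'(b)$ holds iff there is $c\in K$ with $a\leqslant g(c)$ and $f(c)\leqslant b$. -}

module Defs where

open import Level using (Level; _⊔_) renaming (suc to lsuc)
open import Data.Nat using (ℕ; zero; suc; _≤_; _≤′_; ≤′-refl; ≤′-step)
open import Data.Nat.Properties using (≤-refl; m≤n⇒m≤1+n)
open import Data.Product using (Σ; Σ-syntax; ∃; _×_; _,_)
open import Data.Sum using (_⊎_)
open import Relation.Binary.Core using (Rel)
open import Relation.Binary.PropositionalEquality using (_≡_; _≢_)
open import Function.Bundles using (_⇔_)

-- A set equipped with a binary relation (the order); poset axioms are
-- imposed as hypotheses where needed.
record Ord (c ℓ : Level) : Set (lsuc (c ⊔ ℓ)) where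
  field
    Carrier : Set c
    _≤ₒ_    : Rel Carrier ℓ

open Ord public

record Seq (c ℓ : Level) : Set (lsuc (c ⊔ ℓ)) where
  field
    obj : ℕ → Ord c ℓ
    map : (j : ℕ) → Carrier (obj j) → Carrier (obj (suc j))

open Seq public

module _ {c ℓ : Level} (S : Seq c ℓ) where

  compose : {j k : ℕ} → j ≤′ k → Carrier (obj S j) → Carrier (obj S k)
  compose ≤′-refl x = x
  compose (≤′-step {n} p) x = map S n (compose p x)

  -- Σ_n P_n: pairs (x , j) with 0 ≤ j ≤ n, x ∈ P_j (stored as j , j≤n , x)
  StackCarrier : ℕ → Set c
  StackCarrier n = Σ[ j ∈ ℕ ] (j ≤ n × Carrier (obj S j))

  _≤Σ_ : {n : ℕ} → Rel (StackCarrier n) ℓ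
  (j , _ , x) ≤Σ (k , _ , y) = Σ[ p ∈ j ≤′ k ] (obj S k ._≤ₒ_) (compose p x) y

  stackOrd : ℕ → Ord c ℓ
  stackOrd n = record { Carrier = StackCarrier n ; _≤ₒ_ = _≤Σ_ }

stack : {c ℓ : Level} → Seq c ℓ → Seq c ℓ
stack S = record
  { obj = stackOrd S
  ; map = λ { n (j , p , x) → (j , m≤n⇒m≤1+n p , x) } }

iter : {c ℓ : Level} → ℕ → Seq c ℓ → Seq c ℓ
iter zero    S = S
iter (suc k) S = stack (iter k S)

ι : {c ℓ : Level} (S : Seq c ℓ) (n : ℕ) →
    Carrier (obj S n) → Carrier (obj (stack S) n)
ι S n x = (n , ≤-refl , x)

record IsLaxPushout {c ℓ : Level} (K M N L : Ord c ℓ)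
  (f  : Carrier K → Carrier M) (g  : Carrier K → Carrier N)
  (f' : Carrier N → Carrier L) (g' : Carrier M → Carrier L) : Set (c ⊔ ℓ) where
  field
    f'-reflects : ∀ a a′ → (L ._≤ₒ_) (f' a) (f' a′) → (N ._≤ₒ_) a a′
    g'-reflects : ∀ b b′ → (L ._≤ₒ_) (g' b) (g' b′) → (M ._≤ₒ_) b b′
    disjoint    : ∀ a b → f' a ≢ g' b
    covering    : ∀ l → (∃ λ a → f' a ≡ l) ⊎ (∃ λ b → g' b ≡ l)
    downClosed  : ∀ l a → (L ._≤ₒ_) l (f' a) → ∃ λ a′ → f' a′ ≡ l
    comparison  : ∀ a b →
      (L ._≤ₒ_) (f' a) (g' b) ⇔
        (∃ λ c → (N ._≤ₒ_) a (g c) × (M ._≤ₒ_) (f c) b)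

-- Σ_{n+1} M splits into the levels j ≤ n, a down-closed copy of Σ_n M, and the
-- top level n+1, a copy of M_{n+1}; both embeddings reflect the order because
-- the order on a stacking never lowers the level. An element (x, j) of the lower
-- part lies below (y, n+1) iff f_n applied to x pushed up to level n is ≤ y, and
-- that pushed-up element of M_n is the witness c of the comparison condition.

module Submission where

open import Defs
open import Level using (Level; _⊔_)
open import Data.Nat using (ℕ; zero; suc; _≤′_; ≤′-refl; ≤′-step; _≤?_)
open import Data.Nat.Properties
  using (≤-trans; ≤-irrelevant; ≤-antisym; ≰⇒>; ≤′-trans; ≤′⇒≤; 1+n≰n)
open import Data.Product using (∃; _×_; _,_; proj₁)
open import Data.Sum using (_⊎_; inj₁; inj₂)
open import Data.Empty using (⊥-elim)
open import Function.Bundles using (_⇔_; mk⇔)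
open import Relation.Nullary using (yes; no)
open import Relation.Binary.Core using (Rel; _Preserves_⟶_)
open import Relation.Binary.Definitions using (Transitive)
open import Relation.Binary.Structures using (IsPreorder; IsPartialOrder)
open import Relation.Binary.PropositionalEquality
  using (_≡_; _≢_; refl; cong; isEquivalence)

record IsMonotonePreorderSeq {c ℓ : Level} (T : Seq c ℓ) : Set (c ⊔ ℓ) where
  field
    isPreorder : ∀ i → IsPreorder _≡_ (obj T i ._≤ₒ_)
    monotone   : ∀ i → map T i Preserves obj T i ._≤ₒ_ ⟶ obj T (suc i) ._≤ₒ_

  module _ {i : ℕ} where
    open IsPreorder (isPreorder i) public
      renaming (refl to ≤ₒ-refl; reflexive to ≤ₒ-reflexive; trans to ≤ₒ-trans)
      using ()

module _ {c ℓ : Level} (T : Seq c ℓ) where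

  compose-≤′-trans : ∀ {i j k} (p : i ≤′ j) (q : j ≤′ k) x →
                     compose T (≤′-trans p q) x ≡ compose T q (compose T p x)
  compose-≤′-trans p ≤′-refl      x = refl
  compose-≤′-trans p (≤′-step q) x = cong (map T _) (compose-≤′-trans p q x)

  ι-reflects : ∀ {n} x y → (obj (stack T) n ._≤ₒ_) (ι T n x) (ι T n y) →
               (obj T n ._≤ₒ_) x y
  ι-reflects x y (≤′-refl , x≤y)   = x≤y
  ι-reflects x y (≤′-step p , _) = ⊥-elim (1+n≰n (≤′⇒≤ p))

  stack-map-ι-disjoint : ∀ {n} a b → map (stack T) n a ≢ ι T (suc n) b
  stack-map-ι-disjoint (j , j≤n , _) _ eq with cong proj₁ eq
  ... | refl = 1+n≰n j≤n

  stack-map-or-ι : ∀ {n} l →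
    (∃ λ a → map (stack T) n a ≡ l) ⊎ (∃ λ b → ι T (suc n) b ≡ l)
  stack-map-or-ι {n} (j , j≤1+n , x) with j ≤? n
  ... | yes j≤n = inj₁ ((j , j≤n , x) , cong (λ r → j , r , x) (≤-irrelevant _ _))
  ... | no j≰n with ≤-antisym j≤1+n (≰⇒> j≰n)
  ...   | refl = inj₂ (x , cong (λ r → j , r , x) (≤-irrelevant _ _))

  stack-map-downClosed : ∀ {n} l a →
    (obj (stack T) (suc n) ._≤ₒ_) l (map (stack T) n a) →
    ∃ λ a′ → map (stack T) n a′ ≡ l
  stack-map-downClosed (i , _ , x) (j , j≤n , _) (i≤′j , _) =
    (i , ≤-trans (≤′⇒≤ i≤′j) j≤n , x) , cong (λ r → i , r , x) (≤-irrelevant _ _)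

module _ {c ℓ : Level} {T : Seq c ℓ} (T-mono : IsMonotonePreorderSeq T) where
  open IsMonotonePreorderSeq T-mono

  compose-mono : ∀ {i j} (p : i ≤′ j) → compose T p Preserves obj T i ._≤ₒ_ ⟶ obj T j ._≤ₒ_
  compose-mono ≤′-refl     x≤y = x≤y
  compose-mono (≤′-step p) x≤y = monotone _ (compose-mono p x≤y)

  stack-isMonotonePreorderSeq : IsMonotonePreorderSeq (stack T)
  stack-isMonotonePreorderSeq = record
    { isPreorder = λ i → record
      { isEquivalence = isEquivalence
      ; reflexive     = λ { refl → ≤′-refl , ≤ₒ-refl }
      -- η-expanded: the level i is not determined by the relation alone
      ; trans         = λ {a} {b} {d} → stack-trans i {a} {b} {d}
      }
    ; monotone = λ i x≤y → x≤y
    }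
    where
    stack-trans : ∀ n → Transitive (obj (stack T) n ._≤ₒ_)
    stack-trans _ {_ , _ , x} (p , h₁) (q , h₂) =
      ≤′-trans p q ,
      ≤ₒ-trans (≤ₒ-reflexive (compose-≤′-trans T p q x)) (≤ₒ-trans (compose-mono q h₁) h₂)

  stack-comparison : ∀ {n} a b →
    (obj (stack T) (suc n) ._≤ₒ_) (map (stack T) n a) (ι T (suc n) b) ⇔
      (∃ λ c → (obj (stack T) n ._≤ₒ_) a (ι T n c) × (obj T (suc n) ._≤ₒ_) (map T n c) b)
  stack-comparison {n} a@(_ , j≤n , x) b = mk⇔ to from
    where
    _≤ₙ_ : Rel (Carrier (obj (stack T) n)) ℓ
    _≤ₙ_ = obj (stack T) n ._≤ₒ_
    _≤₁₊ₙ_ : Rel (Carrier (obj (stack T) (suc n))) ℓ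
    _≤₁₊ₙ_ = obj (stack T) (suc n) ._≤ₒ_
    _≤ᴹ_ : Rel (Carrier (obj T (suc n))) ℓ
    _≤ᴹ_ = obj T (suc n) ._≤ₒ_

    to : map (stack T) n a ≤₁₊ₙ ι T (suc n) b → ∃ λ c → a ≤ₙ ι T n c × map T n c ≤ᴹ b
    to (≤′-refl , _)   = ⊥-elim (1+n≰n j≤n)
    to (≤′-step p , h) = compose T p x , (p , ≤ₒ-refl) , h
    from : (∃ λ c → a ≤ₙ ι T n c × map T n c ≤ᴹ b) → map (stack T) n a ≤₁₊ₙ ι T (suc n) b
    from (c , (p , h₁) , h₂) = ≤′-step p , ≤ₒ-trans (monotone _ h₁) h₂

  stack-isLaxPushout : ∀ n →
    IsLaxPushout
      (obj T n) (obj T (suc n)) (obj (stack T) n) (obj (stack T) (suc n))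
      (map T n) (ι T n) (map (stack T) n) (ι T (suc n))
  stack-isLaxPushout n = record
    { f'-reflects = λ _ _ h → h
    ; g'-reflects = ι-reflects T
    ; disjoint    = stack-map-ι-disjoint T
    ; covering    = stack-map-or-ι T
    ; downClosed  = stack-map-downClosed T
    ; comparison  = stack-comparison
    }

iter-isMonotonePreorderSeq : {c ℓ : Level} {S : Seq c ℓ} →
  IsMonotonePreorderSeq S → ∀ k → IsMonotonePreorderSeq (iter k S)
iter-isMonotonePreorderSeq S-mono zero    = S-mono
iter-isMonotonePreorderSeq S-mono (suc k) =
  stack-isMonotonePreorderSeq (iter-isMonotonePreorderSeq S-mono k)

lemma4p1 : {c ℓ : Level} (S : Seq c ℓ) →
    (∀ i → IsPartialOrder _≡_ (obj S i ._≤ₒ_)) →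
    (∀ i x y → (obj S i ._≤ₒ_) x y → (obj S (suc i) ._≤ₒ_) (map S i x) (map S i y)) →
    (k n : ℕ) →
    IsLaxPushout
      (obj (iter k S) n) (obj (iter k S) (suc n))
      (obj (iter (suc k) S) n) (obj (iter (suc k) S) (suc n))
      (map (iter k S) n) (ι (iter k S) n)
      (map (iter (suc k) S) n) (ι (iter k S) (suc n))
lemma4p1 S isPartialOrder mono k =
  stack-isLaxPushout (iter-isMonotonePreorderSeq S-mono k)
  where
  S-mono : IsMonotonePreorderSeq S
  S-mono = record
    { isPreorder = λ i → IsPartialOrder.isPreorder (isPartialOrder i)
    ; monotone   = λ i {x} {y} → mono i x y
    }
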